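{- Let $\nu=(\nu_1,\ldots,\nu_t)\in\mathcal{E}_2$. Then for all $1\le i<j\le t$, $\nu_i\triangleright\nu_j+j-i-1$.
   Context: Primary colors $a_1<\cdots<a_n$; secondary colors $a_ia_j$ ($i<j$); total order $a_1a_2<\cdots<a_1a_n<a_1<a_2a_3<\cdots<a_2a_n<a_2<\cdots<a_{n-1}a_n<a_{n-1}<a_n$. A part $k_p$ has integer size $k$ and color $p$; $k_p+m=(k+m)_p$. $k_p\succ l_q$ iff $k-l\ge\chi(p\le q)$; $\succeq$ means $\succ$ or equal. $\mathcal{P}$: parts with primary color and positive size; $\mathcal{S}$: parts with secondary color and size $\ge2$. $k_p\triangleright l_q$ iff $k_p\succeq(l+1)_q$ when $p$ or $q$ is primary, and $k_p\succ(l+1)_q$ when both are secondary. $\mathcal{E}_2$ is the set of finite sequences $(\nu_1,\ldots,\nu_t)$ of parts in $\mathcal{P}\sqcup\mathcal{S}$ with $\nu_1\triangleright\nu_2\triangleright\cdots\triangleright\nu_t$. -}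

module Defs where

open import Data.Nat as ℕ using (ℕ; _<ᵇ_; _≡ᵇ_; _≤ᵇ_)
open import Data.Fin as Fin using (Fin; toℕ)
open import Data.Integer as ℤ using (ℤ; +_; _-_; _≥_)
open import Data.Bool using (Bool; true; false; if_then_else_; _∧_; _∨_)
open import Data.Product using (_×_; _,_)
open import Data.Sum using (_⊎_)
open import Data.List using (List)
open import Data.List.Relation.Unary.All using (All)
open import Data.List.Relation.Unary.Linked using (Linked)
open import Relation.Binary.PropositionalEquality using (_≡_)

-- Colors over n primary colors a_0 < ... < a_{n-1} (0-indexed via Fin n).
data Color (n : ℕ) : Set where
  prim : Fin n → Color n
  sec  : (i j : Fin n) → i Fin.< j → Color n

-- Total order  a1a2 < ... < a1an < a1 < a2a3 < ... < a2an < a2 < ... < a_n :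
-- lexicographic order on the key (i , j) for a_i a_j, and (i , n) for a_i.
key : ∀ {n} → Color n → ℕ × ℕ
key {n} (prim i)    = toℕ i , n
key     (sec i j _) = toℕ i , toℕ j

_≤C_ : ∀ {n} → Color n → Color n → Bool
p ≤C q with key p | key q
... | a , b | c , d = (a <ᵇ c) ∨ ((a ≡ᵇ c) ∧ (b ≤ᵇ d))

isPrim : ∀ {n} → Color n → Bool
isPrim (prim _)    = true
isPrim (sec _ _ _) = false

record Part (n : ℕ) : Set where
  constructor _at_
  field
    size  : ℤ
    color : Color n
open Part public

_+P_ : ∀ {n} → Part n → ℤ → Part n
(k at p) +P m = (k ℤ.+ m) at p

χ : Bool → ℤ
χ b = if b then + 1 else + 0

_≻_ : ∀ {n} → Part n → Part n → Set
(k at p) ≻ (l at q) = (k - l) ≥ χ (p ≤C q)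

_⪰_ : ∀ {n} → Part n → Part n → Set
x ⪰ y = x ≻ y ⊎ x ≡ y

_▷_ : ∀ {n} → Part n → Part n → Set
x ▷ y with isPrim (color x) ∨ isPrim (color y)
... | true  = x ⪰ (y +P (+ 1))
... | false = x ≻ (y +P (+ 1))

data InPS {n : ℕ} : Part n → Set where
  inP : ∀ {k i}   → k ≥ + 1 → InPS (k at prim i)
  inS : ∀ {k i j} (i<j : i Fin.< j) → k ≥ + 2 → InPS (k at sec i j i<j)

ℰ₂ : ∀ {n} → List (Part n) → Set
ℰ₂ ν = All InPS ν × Linked _▷_ ν

module Submission where

-- The proof rests on one observation about the colour order: "p ≤ q" is a
-- total preorder (it is the lexicographic order on the keys of the colours),
-- hence p ≤ r forces p ≤ q or q ≤ r for every q.  This gives the triangle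
-- inequality χ(p ≤ r) ≤ χ(p ≤ q) + χ(q ≤ r), which makes the relation ≻ on
-- parts transitive; ≻ is also invariant under shifting both sizes.
-- From these, ▷ satisfies a shifted transitivity: x ▷ y and y ▷ w give
-- x ▷ (w + 1).  Iterating along the chain, the head of a ▷-linked list
-- dominates its (j+1)-st successor shifted by j; dropping a prefix of the
-- list then yields the statement for arbitrary i < j.

open import Defs
open import Data.Nat using (ℕ; _<_; _∸_)
open import Data.Fin using (Fin; toℕ)
open import Data.Integer using (+_)
open import Data.List using (List; length; lookup)

open import Data.Nat as ℕ using (_≤_; _<ᵇ_; _≡ᵇ_; _≤ᵇ_; z≤n; s≤s)
import Data.Nat.Properties as ℕP
open import Data.Integer as ℤ using (ℤ)
import Data.Integer.Properties as ℤP
open import Data.Integer.Tactic.RingSolver using (solve-∀)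
open import Data.Bool using (true; false; T; _∧_)
open import Data.Bool.Properties using (T-∨; T-∧)
open import Data.Fin as Fin using ()
open import Data.Product using (_×_; _,_)
open import Data.Product.Relation.Binary.Lex.Strict using (×-Lex; ×-transitive; ×-total₂)
open import Data.Sum using (_⊎_; inj₁; inj₂; [_,_])
open import Data.List using (_∷_)
open import Data.List.Relation.Unary.Linked using (Linked; _∷_; tail)
open import Function using (Equivalence; _∘_)
open import Relation.Binary using (Rel; Total; Transitive)
open import Relation.Binary.PropositionalEquality
  using (_≡_; refl; sym; trans; cong; subst; isEquivalence; resp₂)

total-split : ∀ {A : Set} {ℓ} {_≤_ : Rel A ℓ} → Total _≤_ → Transitive _≤_ →
              ∀ {x y z : A} → x ≤ z → x ≤ y ⊎ y ≤ z
total-split total ≤-trans {x} {y} x≤z with total x y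
... | inj₁ x≤y = inj₁ x≤y
... | inj₂ y≤x = inj₂ (≤-trans y≤x x≤z)

_⊑_ : Rel (ℕ × ℕ) _
_⊑_ = ×-Lex _≡_ _<_ _≤_

⊑-total : Total _⊑_
⊑-total = ×-total₂ {_≈₁_ = _≡_} {_<₁_ = _<_} {_<₂_ = _≤_} (λ { refl → refl }) ℕP.<-cmp ℕP.≤-total

⊑-trans : Transitive _⊑_
⊑-trans = ×-transitive {_≈₁_ = _≡_} {_<₁_ = _<_} {_<₂_ = _≤_} isEquivalence (resp₂ _<_) ℕP.<-trans ℕP.≤-trans

≤C⇒⊑ : ∀ {n} (p q : Color n) → T (p ≤C q) → key p ⊑ key q
≤C⇒⊑ p q h with key p | key q
... | a , b | c , d =
  [ inj₁ ∘ ℕP.<ᵇ⇒< a c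
  , (λ { (a≡c , b≤d) → inj₂ (ℕP.≡ᵇ⇒≡ a c a≡c , ℕP.≤ᵇ⇒≤ b d b≤d) })
    ∘ Equivalence.to T-∧
  ] (Equivalence.to T-∨ h)

⊑⇒≤C : ∀ {n} (p q : Color n) → key p ⊑ key q → T (p ≤C q)
⊑⇒≤C p q h with key p | key q
... | a , b | c , d = Equivalence.from T-∨ (lexicographic h)
  where
  lexicographic : (a , b) ⊑ (c , d) → T (a <ᵇ c) ⊎ T ((a ≡ᵇ c) ∧ (b ≤ᵇ d))
  lexicographic (inj₁ a<c)         = inj₁ (ℕP.<⇒<ᵇ a<c)
  lexicographic (inj₂ (a≡c , b≤d)) =
    inj₂ (Equivalence.from T-∧ (ℕP.≡⇒≡ᵇ a c a≡c , ℕP.≤⇒≤ᵇ b≤d))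

≤C-split : ∀ {n} (p q r : Color n) → T (p ≤C r) → T (p ≤C q) ⊎ T (q ≤C r)
≤C-split p q r h with total-split ⊑-total ⊑-trans {key p} {key q} {key r} (≤C⇒⊑ p r h)
... | inj₁ pq = inj₁ (⊑⇒≤C p q pq)
... | inj₂ qr = inj₂ (⊑⇒≤C q r qr)

χ-≤-+ : ∀ a b c → (T c → T a ⊎ T b) → χ c ℤ.≤ χ a ℤ.+ χ b
χ-≤-+ a     b     false _ = ℤP.+-mono-≤ (χ-nonneg a) (χ-nonneg b)
  where
  χ-nonneg : ∀ c → + 0 ℤ.≤ χ c
  χ-nonneg false = ℤ.+≤+ z≤n
  χ-nonneg true  = ℤ.+≤+ z≤n
χ-≤-+ true  false true  _ = ℤP.≤-refl
χ-≤-+ true  true  true  _ = ℤ.+≤+ (s≤s z≤n)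
χ-≤-+ false true  true  _ = ℤP.≤-refl
χ-≤-+ false false true  h with h _
... | inj₁ ()
... | inj₂ ()

χ-triangle : ∀ {n} (p q r : Color n) → χ (p ≤C r) ℤ.≤ χ (p ≤C q) ℤ.+ χ (q ≤C r)
χ-triangle p q r = χ-≤-+ (p ≤C q) (q ≤C r) (p ≤C r) (≤C-split p q r)

module _ {n : ℕ} where

  -- ≻ is transitive: the size gaps add up and dominate the indicator via the triangle inequality.
  ≻-trans : (x y z : Part n) → x ≻ y → y ≻ z → x ≻ z
  ≻-trans (k at p) (l at q) (m at r) x≻y y≻z =
    subst (χ (p ≤C r) ℤ.≤_) (gaps-add k l m)
      (ℤP.≤-trans (χ-triangle p q r) (ℤP.+-mono-≤ x≻y y≻z))
    where
    gaps-add : ∀ (k l m : ℤ) → (k ℤ.- l) ℤ.+ (l ℤ.- m) ≡ k ℤ.- m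
    gaps-add = solve-∀

  -- ≻ only depends on the difference of sizes, so it is invariant under a common shift.
  ≻-shift : (x y : Part n) (s : ℤ) → x ≻ y → (x +P s) ≻ (y +P s)
  ≻-shift (k at p) (l at q) s x≻y = subst (χ (p ≤C q) ℤ.≤_) (shift-cancel k l s) x≻y
    where
    shift-cancel : ∀ (k l s : ℤ) → k ℤ.- l ≡ (k ℤ.+ s) ℤ.- (l ℤ.+ s)
    shift-cancel = solve-∀

  +P-identity : (x : Part n) → x +P (+ 0) ≡ x
  +P-identity (k at p) = cong (_at p) (ℤP.+-identityʳ k)

  +P-suc : (x : Part n) (a : ℕ) → (x +P (+ a)) +P (+ 1) ≡ x +P (+ ℕ.suc a)
  +P-suc (k at p) a = cong (_at p) (trans (ℤP.+-assoc k (+ a) (+ 1))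
                                          (cong (λ m → k ℤ.+ + m) (ℕP.+-comm a 1)))

  ▷-cases : (x y : Part n) → x ▷ y →
            x ≻ (y +P (+ 1)) ⊎ (x ≡ y +P (+ 1) × isPrim (color x) ≡ true)
  ▷-cases (k at prim _)  y                (inj₁ x≻y) = inj₁ x≻y
  ▷-cases (k at prim _)  y                (inj₂ x≡y) = inj₂ (x≡y , refl)
  ▷-cases (k at sec _ _ _) (l at prim _)  (inj₁ x≻y) = inj₁ x≻y
  ▷-cases (k at sec _ _ _) (l at prim _)  (inj₂ ())
  ▷-cases (k at sec _ _ _) (l at sec _ _ _) x≻y      = inj₁ x≻y

  ≻⇒▷ : (x y : Part n) → x ≻ (y +P (+ 1)) → x ▷ y
  ≻⇒▷ (k at prim _)    y                x≻y = inj₁ x≻y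
  ≻⇒▷ (k at sec _ _ _) (l at prim _)    x≻y = inj₁ x≻y
  ≻⇒▷ (k at sec _ _ _) (l at sec _ _ _) x≻y = x≻y

  prim-≡⇒▷ : (x y : Part n) → x ≡ y +P (+ 1) → isPrim (color x) ≡ true → x ▷ y
  prim-≡⇒▷ (k at prim _) y x≡y _ = inj₂ x≡y

  ▷-step : (x y w : Part n) → x ▷ y → y ▷ w → x ▷ (w +P (+ 1))
  ▷-step x y w x▷y y▷w with ▷-cases x y x▷y | ▷-cases y w y▷w
  ... | inj₂ (refl , x-prim) | inj₂ (refl , _) = prim-≡⇒▷ x _ refl x-prim
  ... | inj₁ x≻y             | inj₂ (refl , _) = ≻⇒▷ x _ x≻y
  ... | inj₂ (refl , _)      | inj₁ y≻w        = ≻⇒▷ x _ (≻-shift y (w +P (+ 1)) (+ 1) y≻w)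
  ... | inj₁ x≻y             | inj₁ y≻w        = ≻⇒▷ x _
      (≻-trans x (y +P (+ 1)) ((w +P (+ 1)) +P (+ 1)) x≻y (≻-shift y (w +P (+ 1)) (+ 1) y≻w))

  head-▷ : (x : Part n) (xs : List (Part n)) → Linked _▷_ (x ∷ xs) →
           (j : Fin (length xs)) → x ▷ (lookup xs j +P (+ toℕ j))
  head-▷ x (y ∷ ys) (x▷y ∷ _) Fin.zero = subst (x ▷_) (sym (+P-identity y)) x▷y
  head-▷ x (y ∷ ys) (x▷y ∷ linked) (Fin.suc j) =
    subst (x ▷_) (+P-suc (lookup ys j) (toℕ j))
      (▷-step x y _ x▷y (head-▷ y ys linked j))

  linked-▷ : (ν : List (Part n)) → Linked _▷_ ν → (i j : Fin (length ν)) → toℕ i < toℕ j →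
             lookup ν i ▷ (lookup ν j +P (+ (toℕ j ∸ toℕ i ∸ 1)))
  linked-▷ (x ∷ xs) linked Fin.zero    (Fin.suc j) _       = head-▷ x xs linked j
  linked-▷ (x ∷ xs) linked (Fin.suc i) (Fin.suc j) (s≤s i<j) = linked-▷ xs (tail linked) i j i<j

lemma2p3 : (n : ℕ) (ν : List (Part n)) → ℰ₂ ν →
    (i j : Fin (length ν)) → toℕ i < toℕ j →
    lookup ν i ▷ (lookup ν j +P (+ (toℕ j ∸ toℕ i ∸ 1)))
lemma2p3 n ν (_ , linked) = linked-▷ ν linked
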